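{- Let $F$ be a real quadratic field and let $\eta \in \mathcal{O}_F$. There is a positive constant $C_2$, depending only on $\eta$, such that for all $b, c \in \mathbb{Z}$ with $c \neq 0$, the number $\beta = b + c\eta$ satisfies \[ h(\beta) \leq C_2 |c| \sqrt{|\operatorname{Norm}_{F/\mathbb{Q}}(\beta)|}. \]
   Context: The height of an algebraic number $\beta$ is $h(\beta) = \max_{\sigma:\mathbb{Q}(\beta)\to\mathbb{C}} |\sigma(\beta)|$. -}

module Defs where

open import Data.Nat as ℕ using (ℕ; suc)
open import Data.Nat.Divisibility as ℕD using ()
open import Data.Integer as ℤ using (ℤ)
open import Data.Rational as ℚ using (ℚ; 0ℚ; 1ℚ; _≤_; _<_)
open import Data.List using (List; []; _∷_)
open import Data.Product using (_×_; Σ; ∃; _,_)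
open import Data.Sum using (_⊎_)
open import Relation.Binary.PropositionalEquality using (_≡_)

-- A real quadratic field F = ℚ(√d), given by a squarefree integer d > 1.
record RealQuadraticField : Set where
  field
    d          : ℕ
    1<d        : 1 ℕ.< d
    squarefree : ∀ (p : ℕ) → (p ℕ.* p) ℕD.∣ d → p ≡ 1

open RealQuadraticField public

ι : ℤ → ℚ
ι z = z ℚ./ 1

-- An element a + b √d of F = ℚ(√d) (unique representation, √d irrational).
record Elt (F : RealQuadraticField) : Set where
  constructor _+√d·_
  field
    re : ℚ
    im : ℚ

open Elt public

module _ {F : RealQuadraticField} where

  dℚ : ℚ
  dℚ = ι (ℤ.+ d F)

  infixl 6 _⊕_
  infixl 7 _⊗_
  infix 4 _≤ᴿ_

  _⊕_ : Elt F → Elt F → Elt F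
  (a +√d· b) ⊕ (a' +√d· b') = (a ℚ.+ a') +√d· (b ℚ.+ b')

  _⊗_ : Elt F → Elt F → Elt F
  (a +√d· b) ⊗ (a' +√d· b') =
    ((a ℚ.* a') ℚ.+ (dℚ ℚ.* (b ℚ.* b'))) +√d· ((a ℚ.* b') ℚ.+ (b ℚ.* a'))

  embℚ : ℚ → Elt F
  embℚ q = q +√d· 0ℚ

  embℤ : ℤ → Elt F
  embℤ z = embℚ (ι z)

  -- evaluation of an integer polynomial (coefficient list, constant term first)
  evalPoly : List ℤ → Elt F → Elt F
  evalPoly []       x = embℚ 0ℚ
  evalPoly (a ∷ as) x = embℤ a ⊕ (x ⊗ evalPoly as x)

  Monic : List ℤ → Set
  Monic []           = Data.Empty.⊥ where import Data.Empty
  Monic (a ∷ [])     = a ≡ ℤ.+ 1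
  Monic (a ∷ b ∷ as) = Monic (b ∷ as)

  IsAlgebraicInteger : Elt F → Set
  IsAlgebraicInteger η = Σ (List ℤ) λ P → Monic P × (evalPoly P η ≡ embℚ 0ℚ)

  conj : Elt F → Elt F
  conj (a +√d· b) = a +√d· (ℚ.- b)

  norm : Elt F → ℚ
  norm (a +√d· b) = (a ℚ.* a) ℚ.- (dℚ ℚ.* (b ℚ.* b))

  -- The two embeddings F → ℝ (⊆ ℂ): σ₁ = id (√d ↦ positive root), σ₂ = conj.
  -- Their values are represented as elements of ℚ(√d) ⊆ ℝ via √d ↦ +√d.
  data Embedding : Set where
    σ₁ σ₂ : Embedding

  apply : Embedding → Elt F → Elt F
  apply σ₁ x = x
  apply σ₂ x = conj x

  -- real number a + b√d (√d > 0) is ≥ 0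
  NonNeg : Elt F → Set
  NonNeg (a +√d· b) =
      (0ℚ ≤ a × 0ℚ ≤ b)
    ⊎ (0ℚ ≤ a × b < 0ℚ × dℚ ℚ.* (b ℚ.* b) ≤ a ℚ.* a)
    ⊎ (a < 0ℚ × 0ℚ < b × a ℚ.* a ≤ dℚ ℚ.* (b ℚ.* b))

  _≤ᴿ_ : Elt F → Elt F → Set
  x ≤ᴿ y = NonNeg (y ⊕ (embℚ (ℚ.- 1ℚ) ⊗ x))

module Submission where

-- Write β = A + B√d. As σ₁(β)² + σ₂(β)² = 2(A² + dB²) with both terms ≥ 0, it suffices
-- to prove the trace bound 2(A² + dB²) ≤ K·|A² − dB²| for K = C₂²c²
-- (RealQuadraticForms: square≤ᴿ, embeddings-square≤). Both sides are quadratic in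
-- (A, B), so we may multiply by the common denominator D of the coordinates of η; this
-- turns them into integers X and Y = c·e′ (LinearFormsInη). For integers the bound
-- follows from discreteness and the irrationality of √d (NaturalNumberFacts): if
-- X² ≥ 2dY² then |X² − dY²| is comparable to X² + dY², and otherwise X² + dY² < 3dY²
-- while |X² − dY²| ≥ 1, since X² ≠ dY² unless Y = 0. The integer statements are carried
-- to ℚ by the ordered ring embedding ι : ℤ → ℚ (IntegerEmbedding).
-- The argument works for every η ∈ F.

open import Defs
open import Data.Nat using (ℕ; _<_)
open import Data.Integer using (ℤ; +_)
open import Data.Rational using (∣_∣)
open import Data.Product using (Σ; _×_)
open import Relation.Binary.PropositionalEquality using (_≢_)
open import Data.Nat using (z<s)
open import Data.Rational using (ℚ)
open import Data.Product using (_,_)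
import Data.Integer
import Data.Rational

module NaturalNumberFacts where

  open import Data.Nat
  open import Data.Nat.Properties
  open import Data.Nat.Divisibility using (_∣_; divides; ∣-refl; ∣-reflexive)
  open import Data.Nat.DivMod using (_/_; m/n*n≡m)
  open import Data.Nat.GCD using (gcd; gcd[m,n]∣m; gcd[m,n]∣n; gcd[m,n]≢0)
  open import Data.Nat.Coprimality using (Coprime; coprime-/gcd; coprime-divisor)
  import Data.Nat.Coprimality as Coprimality
  open import Data.Nat.Solver using (module +-*-Solver)
  open +-*-Solver
  open import Data.Sum using (inj₂)
  open import Data.Empty using (⊥-elim)
  open import Relation.Nullary using (yes; no)
  open import Relation.Binary.PropositionalEquality

  -- For distinct u, v the doubled sum 2(u + v) is at most K·|u − v| once
  -- K ≥ 6(1 + v): if u ≥ 2v the gap u − v is at least a third of u + v,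
  -- otherwise u + v ≤ 3v while the gap is at least 1.
  sum≤gap : ∀ {u v K} → u ≢ v → 6 * suc v ≤ K → (u + v) + (u + v) ≤ K * ∣ u - v ∣
  sum≤gap {u} {v} {K} u≢v 6[1+v]≤K with v + v ≤? u
  ... | yes 2v≤u with m≤n⇒∃[o]m+o≡n 2v≤u
  ...   | w , refl = begin
    (v + v + w + v) + (v + v + w + v) ≡⟨ solve 2 (λ v w → (v :+ v :+ w :+ v) :+ (v :+ v :+ w :+ v) := con 6 :* v :+ con 2 :* w) refl v w ⟩
    6 * v + 2 * w                     ≤⟨ +-monoʳ-≤ (6 * v) (*-monoˡ-≤ w {2} {6} (s≤s (s≤s z≤n))) ⟩
    6 * v + 6 * w                     ≡⟨ *-distribˡ-+ 6 v w ⟨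
    6 * (v + w)                       ≤⟨ *-monoˡ-≤ (v + w) (≤-trans (m≤m*n 6 (suc v)) 6[1+v]≤K) ⟩
    K * (v + w)                       ≡⟨ cong (K *_) gap ⟨
    K * ∣ v + v + w - v ∣             ∎
    where
    open ≤-Reasoning
    gap : ∣ v + v + w - v ∣ ≡ v + w
    gap = trans (cong (∣_- v ∣) (+-assoc v v w)) (trans (∣-∣-comm (v + (v + w)) v) (∣m-m+n∣≡n v (v + w)))
  sum≤gap {u} {v} {K} u≢v 6[1+v]≤K | no 2v≰u = begin
    (u + v) + (u + v)   ≤⟨ +-mono-≤ u+v≤3v u+v≤3v ⟩
    (v + v + v) + (v + v + v) ≡⟨ solve 1 (λ v → (v :+ v :+ v) :+ (v :+ v :+ v) := con 6 :* v) refl v ⟩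
    6 * v               ≤⟨ *-monoʳ-≤ 6 (n≤1+n v) ⟩
    6 * suc v           ≤⟨ 6[1+v]≤K ⟩
    K                   ≡⟨ *-identityʳ K ⟨
    K * 1               ≤⟨ *-monoʳ-≤ K (n≢0⇒n>0 (λ gap≡0 → u≢v (∣m-n∣≡0⇒m≡n gap≡0))) ⟩
    K * ∣ u - v ∣       ∎
    where
    open ≤-Reasoning
    u+v≤3v : u + v ≤ v + v + v
    u+v≤3v = +-monoˡ-≤ v (<⇒≤ (≰⇒> 2v≰u))

  module _ (F : RealQuadraticField) where

    -- A coprime pair cannot solve x² = d·y²: y ∣ x² forces y ∣ x, hence y = 1,
    -- so d = x² and squarefreeness gives d = 1, contradicting d > 1.
    coprime-no-solution : ∀ {x y} → Coprime x y → x * x ≢ d F * (y * y)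
    coprime-no-solution {x} {y} x⊥y eq = <⇒≢ (1<d F) (sym d≡1)
      where
      y∣x² : y ∣ x * x
      y∣x² = divides (d F * y) (trans eq (solve 2 (λ d y → d :* (y :* y) := (d :* y) :* y) refl (d F) y))
      y≡1 : y ≡ 1
      y≡1 = x⊥y (coprime-divisor (Coprimality.sym x⊥y) y∣x² , ∣-refl)
      d≡x² : d F ≡ x * x
      d≡x² = sym (trans eq (trans (cong (λ t → d F * (t * t)) y≡1) (*-identityʳ (d F))))
      d≡1 : d F ≡ 1
      d≡1 = trans d≡x² (cong (λ t → t * t) (squarefree F x (∣-reflexive (sym d≡x²))))

    -- √d is irrational: x² = d·y² only for y = 0. A solution with y ≠ 0 would
    -- remain a solution after dividing x and y by gcd(x, y), giving a coprime one.
    sqrt-irrational : ∀ x y → x * x ≡ d F * (y * y) → y ≡ 0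
    sqrt-irrational x y eq with y ≟ 0
    ... | yes y≡0 = y≡0
    ... | no y≢0 = ⊥-elim (coprime-no-solution (coprime-/gcd x y) reduced)
      where
      g : ℕ
      g = gcd x y
      instance
        g≢0 : NonZero g
        g≢0 = ≢-nonZero (gcd[m,n]≢0 x y (inj₂ y≢0))
        g²≢0 : NonZero (g * g)
        g²≢0 = m*n≢0 g g
      x' y' : ℕ
      x' = x / g
      y' = y / g
      reduced : x' * x' ≡ d F * (y' * y')
      reduced = *-cancelʳ-≡ (x' * x') (d F * (y' * y')) (g * g) (begin
        (x' * x') * (g * g)         ≡⟨ solve 2 (λ a b → (a :* a) :* (b :* b) := (a :* b) :* (a :* b)) refl x' g ⟩
        (x' * g) * (x' * g)         ≡⟨ cong (λ t → t * t) (m/n*n≡m (gcd[m,n]∣m x y)) ⟩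
        x * x                       ≡⟨ eq ⟩
        d F * (y * y)               ≡⟨ cong (λ t → d F * (t * t)) (sym (m/n*n≡m (gcd[m,n]∣n x y))) ⟩
        d F * ((y' * g) * (y' * g)) ≡⟨ solve 3 (λ a b c → a :* ((b :* c) :* (b :* c)) := (a :* (b :* b)) :* (c :* c)) refl (d F) y' g ⟩
        d F * (y' * y') * (g * g)   ∎)
        where open ≡-Reasoning

    -- The gap inequality for the norm form x² − d·y². When x² = d·y² the
    -- irrationality of √d forces x = y = 0 and both sides vanish.
    normForm-sum≤gap : ∀ x y {K} → 6 * suc (d F * (y * y)) ≤ K →
      (x * x + d F * (y * y)) + (x * x + d F * (y * y)) ≤ K * ∣ x * x - d F * (y * y) ∣
    normForm-sum≤gap x y {K} bound with x * x ≟ d F * (y * y)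
    ... | no x²≢dy² = sum≤gap x²≢dy² bound
    ... | yes x²≡dy² = subst (_≤ K * ∣ x * x - d F * (y * y) ∣) (sym sum≡0) z≤n
      where
      dy²≡0 : d F * (y * y) ≡ 0
      dy²≡0 = trans (cong (λ t → d F * (t * t)) (sqrt-irrational x y x²≡dy²)) (*-zeroʳ (d F))
      sum≡0 : (x * x + d F * (y * y)) + (x * x + d F * (y * y)) ≡ 0
      sum≡0 = cong₂ (λ p q → (p + q) + (p + q)) (trans x²≡dy² dy²≡0) dy²≡0

  constant-large : ∀ m n → n ≢ 0 → 6 * suc (m * (n * n)) ≤ (6 * suc m) * (6 * suc m) * n * n
  constant-large m zero      0≢0 = ⊥-elim (0≢0 refl)
  constant-large m n@(suc _) _   = begin
    6 * suc (m * (n * n))     ≤⟨ *-monoʳ-≤ 6 (+-monoˡ-≤ (m * (n * n)) (n≢0⇒n>0 {n * n} λ ())) ⟩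
    6 * (suc m * (n * n))     ≡⟨ *-assoc 6 (suc m) (n * n) ⟨
    C * (n * n)               ≤⟨ *-monoˡ-≤ (n * n) (m≤m*n C C) ⟩
    C * C * (n * n)           ≡⟨ *-assoc (C * C) n n ⟨
    C * C * n * n             ∎
    where
    open ≤-Reasoning
    C : ℕ
    C = 6 * suc m

module IntegerEmbedding where

  open import Data.Nat as ℕ using (zero; suc)
  import Data.Nat.Properties as ℕ
  open import Data.Nat.Coprimality using (1-coprimeTo)
  import Data.Nat.Coprimality as Coprimality
  open import Data.Integer as ℤ using (+_; -[1+_]; _⊖_)
  import Data.Integer.Properties as ℤ
  open import Data.Rational using (mkℚ; ↥_; ↧_; _+_; _*_; -_; _-_; ∣_∣; _≤_; *≤*; Positive; toℚᵘ)
  open import Data.Rational.Properties using (normalize-coprime; toℚᵘ-injective; toℚᵘ-homo-*)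
  import Data.Rational.Unnormalised as ℚᵘ
  import Data.Rational.Unnormalised.Properties as ℚᵘ
  open import Relation.Binary.PropositionalEquality

  -- ι z is the reduced fraction z/1; every property of ι below is read off
  -- from this normal form.
  ι-normal : ∀ z → ι z ≡ mkℚ z 0 (Coprimality.sym (1-coprimeTo _))
  ι-normal (+ n)    = normalize-coprime (Coprimality.sym (1-coprimeTo n))
  ι-normal -[1+ n ] = cong -_ (normalize-coprime (Coprimality.sym (1-coprimeTo (suc n))))

  ι-+ : ∀ x y → ι (x ℤ.+ y) ≡ ι x + ι y
  ι-+ x y rewrite ι-normal x | ι-normal y =
    cong ι (sym (cong₂ ℤ._+_ (ℤ.*-identityʳ x) (ℤ.*-identityʳ y)))

  ι-* : ∀ x y → ι (x ℤ.* y) ≡ ι x * ι y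
  ι-* x y rewrite ι-normal x | ι-normal y = refl

  ι-neg : ∀ z → ι (ℤ.- z) ≡ - ι z
  ι-neg (+ zero)   = refl
  ι-neg (+ suc n)  = refl
  ι-neg -[1+ n ]   = trans (ι-normal (+ suc n)) (cong (λ q → - - q) (sym (ι-normal (+ suc n))))

  ι-abs : ∀ z → ∣ ι z ∣ ≡ ι (+ ℤ.∣ z ∣)
  ι-abs z rewrite ι-normal z | ι-normal (+ ℤ.∣ z ∣) = refl

  ι-mono-≤ : ∀ {x y} → x ℤ.≤ y → ι x ≤ ι y
  ι-mono-≤ {x} {y} x≤y rewrite ι-normal x | ι-normal y =
    *≤* (subst₂ ℤ._≤_ (sym (ℤ.*-identityʳ x)) (sym (ℤ.*-identityʳ y)) x≤y)

  ι-positive : ∀ n .{{_ : ℕ.NonZero n}} → Positive (ι (+ n))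
  ι-positive (suc n) rewrite ι-normal (+ suc n) = _

  square-abs : ∀ z → z ℤ.* z ≡ + (ℤ.∣ z ∣ ℕ.* ℤ.∣ z ∣)
  square-abs (+ n)    = sym (ℤ.pos-* n n)
  square-abs -[1+ n ] = refl

  ι-square : ∀ z → ι z * ι z ≡ ι (+ (ℤ.∣ z ∣ ℕ.* ℤ.∣ z ∣))
  ι-square z = trans (sym (ι-* z z)) (cong ι (square-abs z))

  +-square-scaled : ∀ C c → + C ℤ.* + C ℤ.* c ℤ.* c ≡ + (C ℕ.* C ℕ.* ℤ.∣ c ∣ ℕ.* ℤ.∣ c ∣)
  +-square-scaled C c = begin
    + C ℤ.* + C ℤ.* c ℤ.* c               ≡⟨ ℤ.*-assoc (+ C ℤ.* + C) c c ⟩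
    + C ℤ.* + C ℤ.* (c ℤ.* c)             ≡⟨ cong₂ ℤ._*_ (sym (ℤ.pos-* C C)) (square-abs c) ⟩
    + (C ℕ.* C) ℤ.* + (∣c∣ ℕ.* ∣c∣)        ≡⟨ ℤ.pos-* (C ℕ.* C) (∣c∣ ℕ.* ∣c∣) ⟨
    + (C ℕ.* C ℕ.* (∣c∣ ℕ.* ∣c∣))          ≡⟨ cong +_ (ℕ.*-assoc (C ℕ.* C) ∣c∣ ∣c∣) ⟨
    + (C ℕ.* C ℕ.* ∣c∣ ℕ.* ∣c∣)            ∎
    where
    open ≡-Reasoning
    ∣c∣ : ℕ
    ∣c∣ = ℤ.∣ c ∣

  *-denominator : ∀ p → p * ι (↧ p) ≡ ι (↥ p)
  *-denominator p@(mkℚ n d-1 _) = toℚᵘ-injective (begin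
    toℚᵘ (p * ι (↧ p))                   ≈⟨ toℚᵘ-homo-* p (ι (↧ p)) ⟩
    toℚᵘ p ℚᵘ.* toℚᵘ (ι (↧ p))           ≡⟨ cong (λ q → toℚᵘ p ℚᵘ.* toℚᵘ q) (ι-normal (↧ p)) ⟩
    toℚᵘ p ℚᵘ.* ℚᵘ.mkℚᵘ (↧ p) 0          ≈⟨ ℚᵘ.*≡* cross-multiplied ⟩
    ℚᵘ.mkℚᵘ n 0                          ≡⟨ cong toℚᵘ (ι-normal n) ⟨
    toℚᵘ (ι n)                           ∎)
    where
    open ℚᵘ.≃-Reasoning
    cross-multiplied : n ℤ.* ↧ p ℤ.* + 1 ≡ n ℤ.* + suc (d-1 ℕ.* 1)
    cross-multiplied rewrite ℕ.*-identityʳ d-1 = ℤ.*-identityʳ (n ℤ.* + suc d-1)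

  ι-ℕ-+ : ∀ m n → ι (+ (m ℕ.+ n)) ≡ ι (+ m) + ι (+ n)
  ι-ℕ-+ m n = ι-+ (+ m) (+ n)

  ι-ℕ-* : ∀ m n → ι (+ (m ℕ.* n)) ≡ ι (+ m) * ι (+ n)
  ι-ℕ-* m n = trans (cong ι (ℤ.pos-* m n)) (ι-* (+ m) (+ n))

  ι-ℕ-mono-≤ : ∀ {m n} → m ℕ.≤ n → ι (+ m) ≤ ι (+ n)
  ι-ℕ-mono-≤ m≤n = ι-mono-≤ (ℤ.+≤+ m≤n)

  ∣⊖∣≡∣-∣ : ∀ m n → ℤ.∣ m ⊖ n ∣ ≡ ℕ.∣ m - n ∣
  ∣⊖∣≡∣-∣ zero    zero    = refl
  ∣⊖∣≡∣-∣ zero    (suc n) = refl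
  ∣⊖∣≡∣-∣ (suc m) zero    = refl
  ∣⊖∣≡∣-∣ (suc m) (suc n) = trans (cong ℤ.∣_∣ (ℤ.[1+m]⊖[1+n]≡m⊖n m n)) (∣⊖∣≡∣-∣ m n)

  ι-distance : ∀ m n → ∣ ι (+ m) - ι (+ n) ∣ ≡ ι (+ ℕ.∣ m - n ∣)
  ι-distance m n = begin
    ∣ ι (+ m) - ι (+ n) ∣         ≡⟨ cong (λ q → ∣ ι (+ m) + q ∣) (ι-neg (+ n)) ⟨
    ∣ ι (+ m) + ι (ℤ.- + n) ∣     ≡⟨ cong ∣_∣ (ι-+ (+ m) (ℤ.- + n)) ⟨
    ∣ ι (+ m ℤ.+ ℤ.- + n) ∣       ≡⟨ cong (λ z → ∣ ι z ∣) (ℤ.m-n≡m⊖n m n) ⟩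
    ∣ ι (m ⊖ n) ∣                 ≡⟨ ι-abs (m ⊖ n) ⟩
    ι (+ ℤ.∣ m ⊖ n ∣)             ≡⟨ cong (λ k → ι (+ k)) (∣⊖∣≡∣-∣ m n) ⟩
    ι (+ ℕ.∣ m - n ∣)             ∎
    where open ≡-Reasoning

module RealQuadraticForms (F : RealQuadraticField) where

  import Data.Nat as ℕ
  import Data.Integer as ℤ
  open import Data.Rational using (0ℚ; 1ℚ; _+_; _*_; -_; _-_; ∣_∣; _≤_; Positive; nonNegative)
  open import Data.Rational.Properties
  open import Data.Rational.Solver using (module +-*-Solver)
  open +-*-Solver
  open import Data.Sum using (inj₁; inj₂)
  open import Relation.Nullary using (yes; no)
  open import Relation.Binary.PropositionalEquality
  open IntegerEmbedding
  open NaturalNumberFacts using (normForm-sum≤gap)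

  0≤-* : ∀ {x y} → 0ℚ ≤ x → 0ℚ ≤ y → 0ℚ ≤ x * y
  0≤-* {x} {y} 0≤x 0≤y =
    nonNegative⁻¹ (x * y) {{nonNeg*nonNeg⇒nonNeg x {{nonNegative 0≤x}} y {{nonNegative 0≤y}}}}

  0≤-+ : ∀ {x y} → 0ℚ ≤ x → 0ℚ ≤ y → 0ℚ ≤ x + y
  0≤-+ {x} {y} 0≤x 0≤y = subst (_≤ x + y) (+-identityˡ 0ℚ) (+-mono-≤ 0≤x 0≤y)

  0≤square : ∀ x → 0ℚ ≤ x * x
  0≤square x with ≤-total 0ℚ x
  ... | inj₁ 0≤x = 0≤-* 0≤x 0≤x
  ... | inj₂ x≤0 = subst (0ℚ ≤_) (solve 1 (λ x → (:- x) :* (:- x) := x :* x) refl x)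
                     (0≤-* (neg-antimono-≤ x≤0) (neg-antimono-≤ x≤0))

  ≤⇒0≤- : ∀ {x y} → x ≤ y → 0ℚ ≤ y - x
  ≤⇒0≤- {x} {y} x≤y = subst (_≤ y - x) (+-inverseʳ x) (+-monoˡ-≤ (- x) x≤y)

  0≤-⇒≤ : ∀ {x y} → 0ℚ ≤ y - x → x ≤ y
  0≤-⇒≤ {x} {y} 0≤y-x =
    subst₂ _≤_ (+-identityˡ x) (solve 2 (λ x y → (y :- x) :+ x := y) refl x y) (+-monoˡ-≤ x 0≤y-x)

  0≤d : 0ℚ ≤ dℚ {F}
  0≤d = ι-ℕ-mono-≤ {0} {d F} ℕ.z≤n

  -- For x = A + B√d the trace form A² + dB² is (σ₁(x)² + σ₂(x)²)/2 and the
  -- norm form A² − dB² is σ₁(x)·σ₂(x) = norm x.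
  traceForm : ℚ → ℚ → ℚ
  traceForm A B = A * A + dℚ {F} * (B * B)

  normForm : ℚ → ℚ → ℚ
  normForm A B = A * A - dℚ {F} * (B * B)

  -- The inequality 2·traceForm ≤ K·|normForm|, which bounds both σ(x)² by K·|norm x|.
  TraceBound : ℚ → ℚ → ℚ → Set
  TraceBound K A B = traceForm A B + traceForm A B ≤ K * ∣ normForm A B ∣

  0≤traceForm : ∀ A B → 0ℚ ≤ traceForm A B
  0≤traceForm A B = 0≤-+ (0≤square A) (0≤-* 0≤d (0≤square B))

  nonNeg-dominant : ∀ s t → 0ℚ ≤ s → dℚ {F} * (t * t) ≤ s * s → NonNeg {F} (s +√d· t)
  nonNeg-dominant s t 0≤s dt²≤s² with 0ℚ ≤? t
  ... | yes 0≤t = inj₁ (0≤s , 0≤t)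
  ... | no 0≰t  = inj₂ (inj₁ (0≤s , ≰⇒> 0≰t , dt²≤s²))

  -- Indeed Q − (A + B√d)² = s + t√d
  -- with s = Q − P ≥ P ≥ 0 (P the trace form) and t = −2AB, and
  -- s² − d t² = Q(Q − 2P) + N² ≥ 0 (N the norm form).
  square≤ᴿ : ∀ A B Q → traceForm A B + traceForm A B ≤ Q →
    ((A +√d· B) ⊗ (A +√d· B)) ≤ᴿ embℚ {F} Q
  square≤ᴿ A B Q 2P≤Q = nonNeg-dominant s t 0≤s dt²≤s²
    where
    P N : ℚ
    P = traceForm A B
    N = normForm A B
    0≤Q-2P : 0ℚ ≤ Q - (P + P)
    0≤Q-2P = ≤⇒0≤- 2P≤Q
    0≤Q : 0ℚ ≤ Q
    0≤Q = ≤-trans (0≤-+ (0≤traceForm A B) (0≤traceForm A B)) 2P≤Q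
    s t : ℚ
    s = Q + ((- 1ℚ) * P + dℚ {F} * (0ℚ * (A * B + B * A)))
    t = 0ℚ + ((- 1ℚ) * (A * B + B * A) + 0ℚ * P)
    0≤s : 0ℚ ≤ s
    0≤s = subst (0ℚ ≤_)
      (solve 5 (λ A B Q P d → (Q :- (P :+ P)) :+ P
                  := Q :+ ((:- con 1ℚ) :* P :+ d :* (con 0ℚ :* (A :* B :+ B :* A)))) refl A B Q P (dℚ {F}))
      (0≤-+ 0≤Q-2P (0≤traceForm A B))
    dt²≤s² : dℚ {F} * (t * t) ≤ s * s
    dt²≤s² = 0≤-⇒≤ (subst (0ℚ ≤_)
      (solve 4 (λ A B Q d →
          Q :* (Q :- ((A :* A :+ d :* (B :* B)) :+ (A :* A :+ d :* (B :* B))))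
            :+ (A :* A :- d :* (B :* B)) :* (A :* A :- d :* (B :* B))
        := (Q :+ ((:- con 1ℚ) :* (A :* A :+ d :* (B :* B)) :+ d :* (con 0ℚ :* (A :* B :+ B :* A))))
             :* (Q :+ ((:- con 1ℚ) :* (A :* A :+ d :* (B :* B)) :+ d :* (con 0ℚ :* (A :* B :+ B :* A))))
           :- d :* ((con 0ℚ :+ ((:- con 1ℚ) :* (A :* B :+ B :* A) :+ con 0ℚ :* (A :* A :+ d :* (B :* B))))
                   :* (con 0ℚ :+ ((:- con 1ℚ) :* (A :* B :+ B :* A) :+ con 0ℚ :* (A :* A :+ d :* (B :* B))))))
        refl A B Q (dℚ {F}))
      (0≤-+ (0≤-* 0≤Q 0≤Q-2P) (0≤square N)))

  -- The trace form is invariant under conjugation B ↦ −B, so the bound holds for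
  -- both real embeddings at once.
  traceForm-conj : ∀ A B → traceForm A (- B) ≡ traceForm A B
  traceForm-conj A B = cong (λ q → A * A + dℚ {F} * q) (solve 1 (λ B → (:- B) :* (:- B) := B :* B) refl B)

  embeddings-square≤ : ∀ A B Q → traceForm A B + traceForm A B ≤ Q →
    (σ : Embedding) → (apply σ (A +√d· B) ⊗ apply σ (A +√d· B)) ≤ᴿ embℚ {F} Q
  embeddings-square≤ A B Q 2P≤Q σ₁ = square≤ᴿ A B Q 2P≤Q
  embeddings-square≤ A B Q 2P≤Q σ₂ =
    square≤ᴿ A (- B) Q (subst (λ P → P + P ≤ Q) (sym (traceForm-conj A B)) 2P≤Q)

  -- Both sides of a trace bound are quadratic in (A, B), so it may be checked after
  -- scaling (A, B) by any positive rational D.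
  TraceBound-unscale : ∀ K A B D → .{{Positive D}} → TraceBound K (A * D) (B * D) → TraceBound K A B
  TraceBound-unscale K A B D bound = *-cancelʳ-≤-pos (D * D) {{D²-positive}} (subst₂ _≤_ lhs rhs bound)
    where
    D²-positive : Positive (D * D)
    D²-positive = pos*pos⇒pos D D
    0≤D² : 0ℚ ≤ D * D
    0≤D² = 0≤square D
    lhs : traceForm (A * D) (B * D) + traceForm (A * D) (B * D) ≡ (traceForm A B + traceForm A B) * (D * D)
    lhs = solve 4 (λ A B D d → (A :* D :* (A :* D) :+ d :* (B :* D :* (B :* D))) :+ (A :* D :* (A :* D) :+ d :* (B :* D :* (B :* D)))
                 := (A :* A :+ d :* (B :* B) :+ (A :* A :+ d :* (B :* B))) :* (D :* D)) refl A B D (dℚ {F})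
    rhs : K * ∣ normForm (A * D) (B * D) ∣ ≡ K * ∣ normForm A B ∣ * (D * D)
    rhs = begin
      K * ∣ normForm (A * D) (B * D) ∣      ≡⟨ cong (λ q → K * ∣ q ∣)
        (solve 4 (λ A B D d → A :* D :* (A :* D) :- d :* (B :* D :* (B :* D)) := (A :* A :- d :* (B :* B)) :* (D :* D)) refl A B D (dℚ {F})) ⟩
      K * ∣ normForm A B * (D * D) ∣        ≡⟨ cong (K *_) (∣p*q∣≡∣p∣*∣q∣ (normForm A B) (D * D)) ⟩
      K * (∣ normForm A B ∣ * ∣ D * D ∣)    ≡⟨ cong (λ q → K * (∣ normForm A B ∣ * q)) (0≤p⇒∣p∣≡p 0≤D²) ⟩
      K * (∣ normForm A B ∣ * (D * D))      ≡⟨ *-assoc K ∣ normForm A B ∣ (D * D) ⟨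
      K * ∣ normForm A B ∣ * (D * D)        ∎
      where open ≡-Reasoning

  -- Integer points (X, Y) satisfy the trace bound with any K ≥ 6(1 + dY²): this is
  -- the gap inequality for the norm form, read in ℚ.
  TraceBound-ℤ : ∀ X Y K → 6 ℕ.* ℕ.suc (d F ℕ.* (ℤ.∣ Y ∣ ℕ.* ℤ.∣ Y ∣)) ℕ.≤ K →
    TraceBound (ι (+ K)) (ι X) (ι Y)
  TraceBound-ℤ X Y K bound = subst₂ _≤_ lhs rhs (ι-ℕ-mono-≤ (normForm-sum≤gap F x y bound))
    where
    x y u v : ℕ
    x = ℤ.∣ X ∣
    y = ℤ.∣ Y ∣
    u = x ℕ.* x
    v = d F ℕ.* (y ℕ.* y)
    X² : ι X * ι X ≡ ι (+ u)
    X² = ι-square X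
    dY² : dℚ {F} * (ι Y * ι Y) ≡ ι (+ v)
    dY² = trans (cong (dℚ {F} *_) (ι-square Y)) (sym (ι-ℕ-* (d F) (y ℕ.* y)))
    lhs : ι (+ ((u ℕ.+ v) ℕ.+ (u ℕ.+ v))) ≡ traceForm (ι X) (ι Y) + traceForm (ι X) (ι Y)
    lhs = begin
      ι (+ ((u ℕ.+ v) ℕ.+ (u ℕ.+ v)))              ≡⟨ ι-ℕ-+ (u ℕ.+ v) (u ℕ.+ v) ⟩
      ι (+ (u ℕ.+ v)) + ι (+ (u ℕ.+ v))            ≡⟨ cong (λ q → q + q) (ι-ℕ-+ u v) ⟩
      (ι (+ u) + ι (+ v)) + (ι (+ u) + ι (+ v))    ≡⟨ cong (λ q → q + q) (sym (cong₂ _+_ X² dY²)) ⟩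
      traceForm (ι X) (ι Y) + traceForm (ι X) (ι Y) ∎
      where open ≡-Reasoning
    rhs : ι (+ (K ℕ.* ℕ.∣ u - v ∣)) ≡ ι (+ K) * ∣ normForm (ι X) (ι Y) ∣
    rhs = begin
      ι (+ (K ℕ.* ℕ.∣ u - v ∣))            ≡⟨ ι-ℕ-* K ℕ.∣ u - v ∣ ⟩
      ι (+ K) * ι (+ ℕ.∣ u - v ∣)          ≡⟨ cong (ι (+ K) *_) (ι-distance u v) ⟨
      ι (+ K) * ∣ ι (+ u) - ι (+ v) ∣      ≡⟨ cong (λ q → ι (+ K) * ∣ q ∣) (sym (cong₂ _-_ X² dY²)) ⟩
      ι (+ K) * ∣ normForm (ι X) (ι Y) ∣   ∎
      where open ≡-Reasoning

module LinearFormsInη (F : RealQuadraticField) (a e : ℚ) where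

  open import Data.Nat as ℕ using (suc)
  import Data.Nat.Properties as ℕ
  open import Data.Nat.Solver using (module +-*-Solver)
  import Data.Integer as ℤ
  import Data.Integer.Properties as ℤ
  open import Data.Rational using (0ℚ; ↥_; ↧_; ↧ₙ_; _+_; _*_; Positive)
  open import Data.Rational.Solver using (module +-*-Solver)
  open import Relation.Binary.PropositionalEquality
  open IntegerEmbedding
  open NaturalNumberFacts using (constant-large)
  open RealQuadraticForms F

  η : Elt F
  η = a +√d· e

  β : ℤ → ℤ → Elt F
  β b c = embℤ b ⊕ (embℤ c ⊗ η)

  -- The common denominator of the coordinates of η; it clears the denominators of
  -- every β = b + cη.
  D : ℤ
  D = ↧ a ℤ.* ↧ e

  D-positive : Positive (ι D)
  D-positive = subst (λ z → Positive (ι z)) (ℤ.pos-* (↧ₙ a) (↧ₙ e))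
                 (ι-positive (↧ₙ a ℕ.* ↧ₙ e) {{ℕ.m*n≢0 (↧ₙ a) (↧ₙ e)}})

  re-scaled : ∀ b c → re (β b c) * ι D ≡ ι (b ℤ.* D ℤ.+ c ℤ.* (↥ a ℤ.* ↧ e))
  re-scaled b c = begin
    re (β b c) * ι D                                        ≡⟨ cong (re (β b c) *_) (ι-* (↧ a) (↧ e)) ⟩
    re (β b c) * (ι (↧ a) * ι (↧ e))                        ≡⟨ solve 7 (λ b c a e d da de →
        (b :+ ((c :* a) :+ (d :* (con 0ℚ :* e)))) :* (da :* de) := b :* (da :* de) :+ c :* ((a :* da) :* de))
        refl (ι b) (ι c) a e (dℚ {F}) (ι (↧ a)) (ι (↧ e)) ⟩
    ι b * (ι (↧ a) * ι (↧ e)) + ι c * ((a * ι (↧ a)) * ι (↧ e)) ≡⟨ cong (λ q → ι b * (ι (↧ a) * ι (↧ e)) + ι c * (q * ι (↧ e))) (*-denominator a) ⟩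
    ι b * (ι (↧ a) * ι (↧ e)) + ι c * (ι (↥ a) * ι (↧ e))   ≡⟨ cong₂ (λ p q → ι b * p + ι c * q) (ι-* (↧ a) (↧ e)) (ι-* (↥ a) (↧ e)) ⟨
    ι b * ι D + ι c * ι (↥ a ℤ.* ↧ e)                       ≡⟨ cong₂ _+_ (ι-* b D) (ι-* c (↥ a ℤ.* ↧ e)) ⟨
    ι (b ℤ.* D) + ι (c ℤ.* (↥ a ℤ.* ↧ e))                   ≡⟨ ι-+ (b ℤ.* D) (c ℤ.* (↥ a ℤ.* ↧ e)) ⟨
    ι (b ℤ.* D ℤ.+ c ℤ.* (↥ a ℤ.* ↧ e))                     ∎
    where
    open ≡-Reasoning
    open Data.Rational.Solver.+-*-Solver

  im-scaled : ∀ b c → im (β b c) * ι D ≡ ι (c ℤ.* (↥ e ℤ.* ↧ a))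
  im-scaled b c = begin
    im (β b c) * ι D                               ≡⟨ cong (im (β b c) *_) (ι-* (↧ a) (↧ e)) ⟩
    im (β b c) * (ι (↧ a) * ι (↧ e))               ≡⟨ solve 5 (λ c a e da de →
        (con 0ℚ :+ ((c :* e) :+ (con 0ℚ :* a))) :* (da :* de) := c :* ((e :* de) :* da))
        refl (ι c) a e (ι (↧ a)) (ι (↧ e)) ⟩
    ι c * ((e * ι (↧ e)) * ι (↧ a))                ≡⟨ cong (λ q → ι c * (q * ι (↧ a))) (*-denominator e) ⟩
    ι c * (ι (↥ e) * ι (↧ a))                      ≡⟨ cong (ι c *_) (ι-* (↥ e) (↧ a)) ⟨
    ι c * ι (↥ e ℤ.* ↧ a)                          ≡⟨ ι-* c (↥ e ℤ.* ↧ a) ⟨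
    ι (c ℤ.* (↥ e ℤ.* ↧ a))                        ∎
    where
    open ≡-Reasoning
    open Data.Rational.Solver.+-*-Solver

  -- e′ = |e|·D (recall ↥e = e·↧e): the √d-coordinate of η scaled by D.
  e′ : ℕ
  e′ = ℤ.∣ ↥ e ℤ.* ↧ a ∣

  C : ℕ
  C = 6 ℕ.* suc (d F ℕ.* (e′ ℕ.* e′))

  -- Main estimate: 2·traceForm(β) ≤ C²c²·|norm β| for every c ≠ 0. After clearing the
  -- denominator D, β has integer coordinates and the integer trace bound applies.
  traceBound-β : ∀ b c → c ≢ + 0 → TraceBound (ι (+ C ℤ.* + C ℤ.* c ℤ.* c)) (re (β b c)) (im (β b c))
  traceBound-β b c c≢0 =
    subst (λ K → TraceBound K (re (β b c)) (im (β b c))) (cong ι (sym (+-square-scaled C c)))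
      (TraceBound-unscale (ι (+ K)) (re (β b c)) (im (β b c)) (ι D) {{D-positive}}
        (subst₂ (TraceBound (ι (+ K))) (sym (re-scaled b c)) (sym (im-scaled b c))
          (TraceBound-ℤ X Y K K-large)))
    where
    ∣c∣ K : ℕ
    ∣c∣ = ℤ.∣ c ∣
    K = C ℕ.* C ℕ.* ∣c∣ ℕ.* ∣c∣
    X Y : ℤ
    X = b ℤ.* D ℤ.+ c ℤ.* (↥ a ℤ.* ↧ e)
    Y = c ℤ.* (↥ e ℤ.* ↧ a)
    dY²≡ : d F ℕ.* (e′ ℕ.* e′) ℕ.* (∣c∣ ℕ.* ∣c∣) ≡ d F ℕ.* (ℤ.∣ Y ∣ ℕ.* ℤ.∣ Y ∣)
    dY²≡ = trans (solve 3 (λ d e c → d :* (e :* e) :* (c :* c) := d :* ((c :* e) :* (c :* e))) refl (d F) e′ ∣c∣)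
                 (cong (λ y → d F ℕ.* (y ℕ.* y)) (sym (ℤ.abs-* c (↥ e ℤ.* ↧ a))))
      where open Data.Nat.Solver.+-*-Solver
    K-large : 6 ℕ.* suc (d F ℕ.* (ℤ.∣ Y ∣ ℕ.* ℤ.∣ Y ∣)) ℕ.≤ K
    K-large = subst (λ v → 6 ℕ.* suc v ℕ.≤ K) dY²≡
                (constant-large (d F ℕ.* (e′ ℕ.* e′)) ∣c∣ (λ ∣c∣≡0 → c≢0 (ℤ.∣i∣≡0⇒i≡0 ∣c∣≡0)))

lemma5p9 : (F : RealQuadraticField) (η : Elt F) → IsAlgebraicInteger η →
  Σ ℕ λ C₂ → (0 < C₂) × ((b c : ℤ) → c ≢ + 0 →
    let β = embℤ b ⊕ (embℤ c ⊗ η) in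
    (σ : Embedding) →
      (apply σ β ⊗ apply σ β)
        ≤ᴿ embℚ (ι (+ C₂ Data.Integer.* + C₂ Data.Integer.* c Data.Integer.* c) Data.Rational.* ∣ norm β ∣))
lemma5p9 F (a +√d· e) _ = C , z<s , λ b c c≢0 →
  embeddings-square≤ (re (β b c)) (im (β b c)) _ (traceBound-β b c c≢0)
  where
  open LinearFormsInη F a e using (C; β; traceBound-β)
  open RealQuadraticForms F using (embeddings-square≤)
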